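{- Let $q=2^r$, $m\in\mathbb{Z}_{>0}$ and $N_2=(q-1)^m$. For every $a\in\mathbb{F}_q^*$, the Hamming weight of $d(a)$ is \[ w(d(a))=\frac{N_2}{2}-\frac12K(\lambda;a)^m. \]
   Context: $tr:\mathbb{F}_q\to\mathbb{F}_2$ is the absolute trace, $\lambda(x)=(-1)^{tr(x)}$, $K(\lambda;a)=\sum_{\alpha\in\mathbb{F}_q^*}\lambda(\alpha+a\alpha^{ -1})$. Fixing an ordering of $(\mathbb{F}_q^*)^m$, $d(a)\in\mathbb{F}_2^{N_2}$ is the vector whose entry at the tuple $(\alpha_1,\dots,\alpha_m)$ is $tr(a(\alpha_1+\cdots+\alpha_m+\alpha_1^{ -1}+\cdots+\alpha_m^{ -1}))$. -}

module Defs where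

open import Level using (0ℓ)
open import Data.Nat using (ℕ; zero; suc)
open import Data.Integer as ℤ using (ℤ; +_)
open import Data.List using (List; []; _∷_; length; map; filter; concatMap; foldr)
open import Data.List.Membership.Propositional using (_∈_)
open import Data.List.Relation.Unary.Unique.Propositional using (Unique)
open import Data.Vec using (Vec; []; _∷_)
open import Relation.Binary.PropositionalEquality using (_≡_; _≢_)
open import Relation.Binary.Definitions using (DecidableEquality)
open import Relation.Nullary using (yes; no; ¬?)
open import Algebra.Structures using (IsCommutativeRing)

-- The inverse is only constrained on
-- nonzero elements.
record FiniteField : Set₁ where
  infixl 7 _*_
  infixl 6 _+_
  field
    Carrier  : Set
    _+_ _*_  : Carrier → Carrier → Carrier
    -_       : Carrier → Carrier
    0# 1#    : Carrier
    isCommutativeRing : IsCommutativeRing _≡_ _+_ _*_ -_ 0# 1#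
    _⁻¹      : Carrier → Carrier
    inverseʳ : ∀ x → x ≢ 0# → x * (x ⁻¹) ≡ 1#
    0≢1      : 0# ≢ 1#
    _≟_      : DecidableEquality Carrier
    elements : List Carrier
    elements-unique   : Unique elements
    elements-complete : ∀ x → x ∈ elements

module FF (F : FiniteField) where
  open FiniteField F

  q : ℕ
  q = length elements

  nonzero : List Carrier
  nonzero = filter (λ x → ¬? (x ≟ 0#)) elements

  frob : ℕ → Carrier → Carrier
  frob zero    x = x
  frob (suc i) x = frob i x * frob i x

  -- absolute trace F_{2^r} → F_2 ⊆ F : tr x = Σ_{i<r} x^(2^i)
  tr : (r : ℕ) → Carrier → Carrier
  tr zero    x = 0#
  tr (suc i) x = tr i x + frob i x

  -- λ(x) = (-1)^{tr x}  (tr x ∈ {0,1})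
  λχ : ℕ → Carrier → ℤ
  λχ r x with tr r x ≟ 0#
  ... | yes _ = + 1
  ... | no  _ = ℤ.- (+ 1)

  sumℤ : List ℤ → ℤ
  sumℤ = foldr ℤ._+_ (+ 0)

  K : ℕ → Carrier → ℤ
  K r a = sumℤ (map (λ α → λχ r (α + a * (α ⁻¹))) nonzero)

  tuples : (m : ℕ) → List Carrier → List (Vec Carrier m)
  tuples zero    xs = [] ∷ []
  tuples (suc m) xs = concatMap (λ x → map (x ∷_) (tuples m xs)) xs

  tupleSum : ∀ {m} → Vec Carrier m → Carrier
  tupleSum []       = 0#
  tupleSum (α ∷ αs) = (α + α ⁻¹) + tupleSum αs

  -- the codeword d(a) ∈ F_2^{N_2}, entries tr(a (Σ αᵢ + Σ αᵢ⁻¹)) ∈ {0,1} ⊆ F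
  d : ℕ → (m : ℕ) → Carrier → List Carrier
  d r m a = map (λ αs → tr r (a * tupleSum αs)) (tuples m nonzero)

  weight : List Carrier → ℕ
  weight v = length (filter (λ x → ¬? (x ≟ 0#)) v)

{-# OPTIONS --safe #-}
-- Since q = 2^r, Fermat's little theorem x^q = x forces characteristic 2, so squaring
-- is additive, the trace is additive and takes values in {0,1} = F₂, and λ is an
-- additive character.  Counting ±1 entries, 2·w(d(a)) = N₂ − Σ λ(a(α₁+α₁⁻¹+⋯+αₘ+αₘ⁻¹)),
-- and the sum over m-tuples factorises into the m-th power of Σ_β λ(a(β+β⁻¹)).  The
-- substitution β = α²/a permutes F^* and turns a(β+β⁻¹) into (α + aα⁻¹)², whose trace
-- equals that of α + aα⁻¹; hence that power is K(λ;a)^m.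
module Submission where

open import Defs
open import Data.Nat using (ℕ; _^_; _∸_; _<_)
open import Data.Integer using (ℤ; +_; _-_; _*_)
open import Data.Integer using () renaming (_^_ to _^ℤ_)
open import Relation.Binary.PropositionalEquality using (_≡_; _≢_)

open import Level using (0ℓ)
open import Algebra.Bundles using (CommutativeRing)
open import Algebra.Structures using (IsCommutativeMonoid)
import Algebra.Properties.CommutativeSemigroup as CommutativeSemigroupProperties
import Algebra.Properties.Ring as RingProperties
import Algebra.Properties.Semiring.Exp as ExpProperties
import Data.Integer as ℤ
import Data.Integer.Properties as ℤₚ
open import Data.Integer.Tactic.RingSolver using (solve-∀)
open import Data.Nat using (zero; suc)
import Data.Nat as ℕ
import Data.Nat.Properties as ℕₚ
open import Data.Empty using (⊥; ⊥-elim)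
open import Data.List using (List; []; _∷_; _++_; length; map; concatMap; foldr)
open import Data.List.Properties using (length-++; length-map; map-∘; map-cong; map-cong-local)
open import Data.List.Membership.Propositional using (_∈_)
open import Data.List.Membership.Propositional.Properties using (∈-filter⁺; ∈-filter⁻; ∈-map⁺; ∈-map⁻)
open import Data.List.Membership.Propositional.Properties.WithK using (unique∧set⇒bag)
open import Data.List.Relation.Binary.BagAndSetEquality using (∼bag⇒↭)
open import Data.List.Relation.Binary.Permutation.Propositional using (_↭_; ↭⇒↭ₛ)
open import Data.List.Relation.Binary.Permutation.Propositional.Properties using (↭-length) renaming (map⁺ to ↭-map⁺)
open import Data.List.Relation.Binary.Permutation.Setoid.Properties using (foldr-commMonoid)
open import Data.List.Relation.Unary.All as All using (All)
open import Data.List.Relation.Unary.All.Properties using (all-filter)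
open import Data.List.Relation.Unary.Any using (here; there)
open import Data.List.Relation.Unary.Unique.Propositional using (Unique; _∷_)
import Data.List.Relation.Unary.Unique.Propositional.Properties as Unique
open import Data.Product using (∃; _×_; _,_; proj₂)
open import Data.Sum using (_⊎_; inj₁; inj₂)
open import Data.Vec using (Vec; []; _∷_)
open import Function.Base using (_∘_)
open import Function.Bundles using (mk⇔)
open import Relation.Binary.PropositionalEquality using (refl; sym; trans; cong; cong₂; setoid; module ≡-Reasoning)
open import Relation.Nullary using (yes; no; ¬?)

open ≡-Reasoning

unique∧sameElements⇒↭ : ∀ {a} {A : Set a} {xs ys : List A} → Unique xs → Unique ys →
                        (∀ {z} → z ∈ xs → z ∈ ys) → (∀ {z} → z ∈ ys → z ∈ xs) → xs ↭ ys
unique∧sameElements⇒↭ xs! ys! xs⊆ys ys⊆xs = ∼bag⇒↭ (unique∧set⇒bag xs! ys! (mk⇔ xs⊆ys ys⊆xs))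

foldr-↭ : ∀ {a} {A : Set a} {_∙_ : A → A → A} {ε : A} → IsCommutativeMonoid _≡_ _∙_ ε →
          ∀ {xs ys} → xs ↭ ys → foldr _∙_ ε xs ≡ foldr _∙_ ε ys
foldr-↭ {A = A} isCommutativeMonoid xs↭ys =
  foldr-commMonoid (setoid A) isCommutativeMonoid (↭⇒↭ₛ xs↭ys)

m≡n+o⇒n≡m-o : ∀ {m n o : ℤ} → m ≡ n ℤ.+ o → n ≡ m ℤ.- o
m≡n+o⇒n≡m-o {m} {n} {o} m≡n+o = trans (n≡n+o-o n o) (cong (ℤ._- o) (sym m≡n+o))
  where
  n≡n+o-o : ∀ n o → n ≡ n ℤ.+ o ℤ.- o
  n≡n+o-o = solve-∀

module FiniteFieldProperties (F : FiniteField) where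

  open FiniteField F renaming (_*_ to _·_)
  open FF F

  commutativeRing : CommutativeRing 0ℓ 0ℓ
  commutativeRing = record { isCommutativeRing = isCommutativeRing }

  open CommutativeRing commutativeRing
    using ( +-identityˡ; +-identityʳ; +-assoc; +-comm; -‿inverseʳ
          ; *-identityˡ; *-identityʳ; *-assoc; *-comm; zeroˡ; zeroʳ; distribˡ; distribʳ
          ; *-isCommutativeMonoid; ring; semiring; +-commutativeSemigroup; *-commutativeSemigroup )
  open RingProperties ring using (-1*x≈-x; -‿involutive; +-cancelʳ)
  open ExpProperties semiring using (^-homo-*) renaming (_^_ to _^ᶠ_)
  open CommutativeSemigroupProperties +-commutativeSemigroup
    using () renaming (interchange to +-interchange; xy∙z≈xz∙y to xy+z≡xz+y)
  open CommutativeSemigroupProperties *-commutativeSemigroup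
    using () renaming (interchange to ·-interchange)

  1≢0 : 1# ≢ 0#
  1≢0 1≡0 = 0≢1 (sym 1≡0)

  inverseˡ : ∀ x → x ≢ 0# → x ⁻¹ · x ≡ 1#
  inverseˡ x x≢0 = trans (*-comm (x ⁻¹) x) (inverseʳ x x≢0)

  ⁻¹·-cancelˡ : ∀ {x} y → x ≢ 0# → x ⁻¹ · (x · y) ≡ y
  ⁻¹·-cancelˡ {x} y x≢0 = begin
    x ⁻¹ · (x · y)  ≡⟨ *-assoc (x ⁻¹) x y ⟨
    (x ⁻¹ · x) · y  ≡⟨ cong (_· y) (inverseˡ x x≢0) ⟩
    1# · y          ≡⟨ *-identityˡ y ⟩
    y               ∎

  ·⁻¹-cancelˡ : ∀ {x} y → x ≢ 0# → x · (x ⁻¹ · y) ≡ y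
  ·⁻¹-cancelˡ {x} y x≢0 = begin
    x · (x ⁻¹ · y)  ≡⟨ *-assoc x (x ⁻¹) y ⟨
    (x · x ⁻¹) · y  ≡⟨ cong (_· y) (inverseʳ x x≢0) ⟩
    1# · y          ≡⟨ *-identityˡ y ⟩
    y               ∎

  ·-cancelˡ : ∀ {x y z} → x ≢ 0# → x · y ≡ x · z → y ≡ z
  ·-cancelˡ {x} {y} {z} x≢0 xy≡xz = begin
    y               ≡⟨ ⁻¹·-cancelˡ y x≢0 ⟨
    x ⁻¹ · (x · y)  ≡⟨ cong (x ⁻¹ ·_) xy≡xz ⟩
    x ⁻¹ · (x · z)  ≡⟨ ⁻¹·-cancelˡ z x≢0 ⟩
    z               ∎

  ·-nonzero : ∀ {x y} → x ≢ 0# → y ≢ 0# → x · y ≢ 0#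
  ·-nonzero {x} x≢0 y≢0 xy≡0 = y≢0 (·-cancelˡ x≢0 (trans xy≡0 (sym (zeroʳ x))))

  x·x≡0⇒x≡0 : ∀ {x} → x · x ≡ 0# → x ≡ 0#
  x·x≡0⇒x≡0 {x} x·x≡0 with x ≟ 0#
  ... | yes x≡0 = x≡0
  ... | no  x≢0 = ⊥-elim (·-nonzero x≢0 x≢0 x·x≡0)

  ⁻¹-nonzero : ∀ {x} → x ≢ 0# → x ⁻¹ ≢ 0#
  ⁻¹-nonzero {x} x≢0 x⁻¹≡0 = 0≢1 (begin
    0#          ≡⟨ zeroʳ x ⟨
    x · 0#      ≡⟨ cong (x ·_) x⁻¹≡0 ⟨
    x · x ⁻¹    ≡⟨ inverseʳ x x≢0 ⟩
    1#          ∎)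

  ⁻¹-unique : ∀ {x y} → x · y ≡ 1# → x ⁻¹ ≡ y
  ⁻¹-unique {x} {y} xy≡1 = ·-cancelˡ x≢0 (trans (inverseʳ x x≢0) (sym xy≡1))
    where
    x≢0 : x ≢ 0#
    x≢0 x≡0 = 0≢1 (trans (trans (sym (zeroˡ y)) (cong (_· y) (sym x≡0))) xy≡1)

  IsBit : Carrier → Set
  IsBit x = x ≡ 0# ⊎ x ≡ 1#

  x·x≡x⇒IsBit : ∀ {x} → x · x ≡ x → IsBit x
  x·x≡x⇒IsBit {x} x·x≡x with x ≟ 0#
  ... | yes x≡0 = inj₁ x≡0
  ... | no  x≢0 = inj₂ (·-cancelˡ x≢0 (trans x·x≡x (sym (*-identityʳ x))))

  ∈-nonzero⁺ : ∀ {x} → x ≢ 0# → x ∈ nonzero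
  ∈-nonzero⁺ {x} x≢0 = ∈-filter⁺ (λ y → ¬? (y ≟ 0#)) (elements-complete x) x≢0

  ∈-nonzero⁻ : ∀ {x} → x ∈ nonzero → x ≢ 0#
  ∈-nonzero⁻ x∈ = proj₂ (∈-filter⁻ (λ y → ¬? (y ≟ 0#)) {xs = elements} x∈)

  nonzero-unique : Unique nonzero
  nonzero-unique = Unique.filter⁺ (λ y → ¬? (y ≟ 0#)) elements-unique

  elements↭0∷nonzero : elements ↭ 0# ∷ nonzero
  elements↭0∷nonzero =
    unique∧sameElements⇒↭ elements-unique (0∉nonzero ∷ nonzero-unique) split (λ {x} _ → elements-complete x)
    where
    0∉nonzero : All (0# ≢_) nonzero
    0∉nonzero = All.tabulate (λ x∈ 0≡x → ∈-nonzero⁻ x∈ (sym 0≡x))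
    split : ∀ {x} → x ∈ elements → x ∈ 0# ∷ nonzero
    split {x} _ with x ≟ 0#
    ... | yes refl = here refl
    ... | no  x≢0  = there (∈-nonzero⁺ x≢0)

  q≡1+∣nonzero∣ : q ≡ suc (length nonzero)
  q≡1+∣nonzero∣ = ↭-length elements↭0∷nonzero

  q≢1 : q ≢ 1
  q≢1 q≡1 = empty (ℕₚ.suc-injective (trans (sym q≡1+∣nonzero∣) q≡1)) (∈-nonzero⁺ 1≢0)
    where
    empty : ∀ {xs : List Carrier} → length xs ≡ 0 → 1# ∈ xs → ⊥
    empty {[]} _ ()

  map-↭-nonzero : (h : Carrier → Carrier) → (∀ {x y} → h x ≡ h y → x ≡ y) →
                  (∀ {x} → x ≢ 0# → h x ≢ 0#) →
                  (∀ {y} → y ≢ 0# → ∃ λ x → x ≢ 0# × h x ≡ y) →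
                  map h nonzero ↭ nonzero
  map-↭-nonzero h h-injective h-nonzero h-surjective =
    unique∧sameElements⇒↭ (Unique.map⁺ h-injective nonzero-unique) nonzero-unique image⊆ ⊆image
    where
    image⊆ : ∀ {y} → y ∈ map h nonzero → y ∈ nonzero
    image⊆ y∈ with ∈-map⁻ h y∈
    ... | _ , x∈ , refl = ∈-nonzero⁺ (h-nonzero (∈-nonzero⁻ x∈))
    ⊆image : ∀ {y} → y ∈ nonzero → y ∈ map h nonzero
    ⊆image y∈ with h-surjective (∈-nonzero⁻ y∈)
    ... | _ , x≢0 , refl = ∈-map⁺ h (∈-nonzero⁺ x≢0)

  ·-↭-nonzero : ∀ {a} → a ≢ 0# → map (a ·_) nonzero ↭ nonzero
  ·-↭-nonzero {a} a≢0 = map-↭-nonzero (a ·_) (·-cancelˡ a≢0) (·-nonzero a≢0)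
    (λ {y} y≢0 → a ⁻¹ · y , ·-nonzero (⁻¹-nonzero a≢0) y≢0 , ·⁻¹-cancelˡ y a≢0)

  product : List Carrier → Carrier
  product = foldr _·_ 1#

  product-map-· : ∀ x ys → product (map (x ·_) ys) ≡ x ^ᶠ length ys · product ys
  product-map-· x []       = sym (*-identityˡ 1#)
  product-map-· x (y ∷ ys) = trans (cong ((x · y) ·_) (product-map-· x ys))
                                   (·-interchange x y (x ^ᶠ length ys) (product ys))

  product-nonzero : ∀ {ys} → All (_≢ 0#) ys → product ys ≢ 0#
  product-nonzero All.[]             = 1≢0
  product-nonzero (y≢0 All.∷ ys≢0) = ·-nonzero y≢0 (product-nonzero ys≢0)

  -- Fermat: multiplication by x permutes F^*, so it fixes the product of F^*.
  x^∣nonzero∣≡1 : ∀ {x} → x ≢ 0# → x ^ᶠ length nonzero ≡ 1#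
  x^∣nonzero∣≡1 {x} x≢0 = ·-cancelˡ (product-nonzero (all-filter (λ y → ¬? (y ≟ 0#)) elements)) (begin
    P · x ^ᶠ length nonzero        ≡⟨ *-comm P _ ⟩
    x ^ᶠ length nonzero · P        ≡⟨ product-map-· x nonzero ⟨
    product (map (x ·_) nonzero)   ≡⟨ foldr-↭ *-isCommutativeMonoid (·-↭-nonzero x≢0) ⟩
    P                              ≡⟨ *-identityʳ P ⟨
    P · 1#                         ∎)
    where
    P = product nonzero

  x^q≡x : ∀ x → x ^ᶠ q ≡ x
  x^q≡x x with x ≟ 0#
  ... | yes refl = trans (cong (0# ^ᶠ_) q≡1+∣nonzero∣) (zeroˡ _)
  ... | no  x≢0  = begin
    x ^ᶠ q                         ≡⟨ cong (x ^ᶠ_) q≡1+∣nonzero∣ ⟩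
    x · x ^ᶠ length nonzero        ≡⟨ cong (x ·_) (x^∣nonzero∣≡1 x≢0) ⟩
    x · 1#                         ≡⟨ *-identityʳ x ⟩
    x                              ∎

  frob≡^ : ∀ i x → frob i x ≡ x ^ᶠ (2 ^ i)
  frob≡^ zero    x = sym (*-identityʳ x)
  frob≡^ (suc i) x = begin
    frob i x · frob i x              ≡⟨ cong₂ _·_ (frob≡^ i x) (frob≡^ i x) ⟩
    x ^ᶠ (2 ^ i) · x ^ᶠ (2 ^ i)      ≡⟨ ^-homo-* x (2 ^ i) (2 ^ i) ⟨
    x ^ᶠ (2 ^ i ℕ.+ 2 ^ i)           ≡⟨ cong (λ n → x ^ᶠ (2 ^ i ℕ.+ n)) (ℕₚ.+-identityʳ (2 ^ i)) ⟨
    x ^ᶠ (2 ^ suc i)                 ∎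

  frob-fixed : ∀ {r} → q ≡ 2 ^ r → ∀ x → frob r x ≡ x
  frob-fixed {r} q≡2^r x = trans (frob≡^ r x) (trans (cong (x ^ᶠ_) (sym q≡2^r)) (x^q≡x x))

  frob-sq : ∀ i x → frob i (x · x) ≡ frob (suc i) x
  frob-sq zero    x = refl
  frob-sq (suc i) x = cong (λ y → y · y) (frob-sq i x)

  frob-0 : ∀ i → frob i 0# ≡ 0#
  frob-0 zero    = refl
  frob-0 (suc i) = trans (cong (λ y → y · y) (frob-0 i)) (zeroˡ 0#)

  frob-1 : ∀ i → frob i 1# ≡ 1#
  frob-1 zero    = refl
  frob-1 (suc i) = trans (cong (λ y → y · y) (frob-1 i)) (*-identityˡ 1#)

  tr-0 : ∀ i → tr i 0# ≡ 0#
  tr-0 zero    = refl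
  tr-0 (suc i) = trans (cong₂ _+_ (tr-0 i) (frob-0 i)) (+-identityʳ 0#)

  tr-sq+x≡tr+frob : ∀ i x → tr i (x · x) + x ≡ tr i x + frob i x
  tr-sq+x≡tr+frob zero    x = refl
  tr-sq+x≡tr+frob (suc i) x = begin
    (tr i (x · x) + frob i (x · x)) + x   ≡⟨ xy+z≡xz+y (tr i (x · x)) (frob i (x · x)) x ⟩
    (tr i (x · x) + x) + frob i (x · x)   ≡⟨ cong₂ _+_ (tr-sq+x≡tr+frob i x) (frob-sq i x) ⟩
    (tr i x + frob i x) + frob (suc i) x  ∎

  -1≡1 : ∀ {r} → q ≡ 2 ^ suc r → - 1# ≡ 1#
  -1≡1 {r} q≡2^[1+r] = begin
    - 1#                    ≡⟨ frob-fixed {suc r} q≡2^[1+r] (- 1#) ⟨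
    frob (suc r) (- 1#)     ≡⟨ frob-sq r (- 1#) ⟨
    frob r (- 1# · - 1#)    ≡⟨ cong (frob r) (trans (-1*x≈-x (- 1#)) (-‿involutive 1#)) ⟩
    frob r 1#               ≡⟨ frob-1 r ⟩
    1#                      ∎

  x+x≡0 : ∀ {r} → q ≡ 2 ^ suc r → ∀ x → x + x ≡ 0#
  x+x≡0 {r} q≡2^[1+r] x = begin
    x + x                ≡⟨ cong₂ _+_ (*-identityʳ x) (*-identityʳ x) ⟨
    x · 1# + x · 1#      ≡⟨ distribˡ x 1# 1# ⟨
    x · (1# + 1#)        ≡⟨ cong (λ y → x · (1# + y)) (-1≡1 {r} q≡2^[1+r]) ⟨
    x · (1# + - 1#)      ≡⟨ cong (x ·_) (-‿inverseʳ 1#) ⟩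
    x · 0#               ≡⟨ zeroʳ x ⟩
    0#                   ∎

  module Characteristic2 (x+x≡0# : ∀ x → x + x ≡ 0#) where

    sq-+ : ∀ x y → (x + y) · (x + y) ≡ x · x + y · y
    sq-+ x y = begin
      (x + y) · (x + y)                     ≡⟨ distribʳ (x + y) x y ⟩
      x · (x + y) + y · (x + y)             ≡⟨ cong₂ _+_ (distribˡ x x y) (distribˡ y x y) ⟩
      (x · x + x · y) + (y · x + y · y)     ≡⟨ cong (_+_ (x · x + x · y)) (+-comm (y · x) (y · y)) ⟩
      (x · x + x · y) + (y · y + y · x)     ≡⟨ +-interchange (x · x) (x · y) (y · y) (y · x) ⟩
      (x · x + y · y) + (x · y + y · x)     ≡⟨ cong (λ z → (x · x + y · y) + (x · y + z)) (*-comm y x) ⟩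
      (x · x + y · y) + (x · y + x · y)     ≡⟨ cong (_+_ (x · x + y · y)) (x+x≡0# (x · y)) ⟩
      (x · x + y · y) + 0#                  ≡⟨ +-identityʳ _ ⟩
      x · x + y · y                         ∎

    sq-injective : ∀ {x y} → x · x ≡ y · y → x ≡ y
    sq-injective {x} {y} x²≡y² = begin
      x               ≡⟨ +-identityʳ x ⟨
      x + 0#          ≡⟨ cong (_+_ x) (x+x≡0# y) ⟨
      x + (y + y)     ≡⟨ +-assoc x y y ⟨
      (x + y) + y     ≡⟨ cong (_+ y) x+y≡0 ⟩
      0# + y          ≡⟨ +-identityˡ y ⟩
      y               ∎
      where
      x+y≡0 : x + y ≡ 0#
      x+y≡0 = x·x≡0⇒x≡0 (trans (sq-+ x y) (trans (cong (_+ y · y) x²≡y²) (x+x≡0# (y · y))))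

    frob-+ : ∀ i x y → frob i (x + y) ≡ frob i x + frob i y
    frob-+ zero    x y = refl
    frob-+ (suc i) x y = trans (cong (λ z → z · z) (frob-+ i x y)) (sq-+ (frob i x) (frob i y))

    tr-+ : ∀ i x y → tr i (x + y) ≡ tr i x + tr i y
    tr-+ zero    x y = sym (+-identityʳ 0#)
    tr-+ (suc i) x y = begin
      tr i (x + y) + frob i (x + y)               ≡⟨ cong₂ _+_ (tr-+ i x y) (frob-+ i x y) ⟩
      (tr i x + tr i y) + (frob i x + frob i y)   ≡⟨ +-interchange (tr i x) (tr i y) (frob i x) (frob i y) ⟩
      (tr i x + frob i x) + (tr i y + frob i y)   ∎

    tr²≡tr-sq : ∀ i x → tr i x · tr i x ≡ tr i (x · x)
    tr²≡tr-sq zero    x = zeroˡ 0#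
    tr²≡tr-sq (suc i) x = trans (sq-+ (tr i x) (frob i x)) (cong₂ _+_ (tr²≡tr-sq i x) (sym (frob-sq i x)))

  sign : Carrier → ℤ
  sign x with x ≟ 0#
  ... | yes _ = + 1
  ... | no  _ = ℤ.- + 1

  sign-0 : sign 0# ≡ + 1
  sign-0 with 0# ≟ 0#
  ... | yes _   = refl
  ... | no  0≢0 = ⊥-elim (0≢0 refl)

  sign-≢0 : ∀ {x} → x ≢ 0# → sign x ≡ ℤ.- + 1
  sign-≢0 {x} x≢0 with x ≟ 0#
  ... | yes x≡0 = ⊥-elim (x≢0 x≡0)
  ... | no  _   = refl

  λχ≡sign∘tr : ∀ r x → λχ r x ≡ sign (tr r x)
  λχ≡sign∘tr r x with tr r x ≟ 0#
  ... | yes _ = refl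
  ... | no  _ = refl

  length≡2*weight+Σsign : ∀ v → + length v ≡ + 2 ℤ.* + weight v ℤ.+ sumℤ (map sign v)
  length≡2*weight+Σsign []      = refl
  -- Once x ≟ 0# is decided, both weight (x ∷ v) and sign x compute.
  length≡2*weight+Σsign (x ∷ v) with x ≟ 0#
  ... | yes _ = trans (cong (ℤ._+_ (+ 1)) (length≡2*weight+Σsign v)) (zero-entry (+ weight v) (sumℤ (map sign v)))
    where
    zero-entry : ∀ w s → + 1 ℤ.+ (+ 2 ℤ.* w ℤ.+ s) ≡ + 2 ℤ.* w ℤ.+ (+ 1 ℤ.+ s)
    zero-entry = solve-∀
  ... | no  _ = trans (cong (ℤ._+_ (+ 1)) (length≡2*weight+Σsign v)) (nonzero-entry (+ weight v) (sumℤ (map sign v)))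
    where
    nonzero-entry : ∀ w s → + 1 ℤ.+ (+ 2 ℤ.* w ℤ.+ s) ≡ + 2 ℤ.* (+ 1 ℤ.+ w) ℤ.+ (ℤ.- + 1 ℤ.+ s)
    nonzero-entry = solve-∀

  sumℤ-map-++ : ∀ {A : Set} (f : A → ℤ) xs ys →
                sumℤ (map f (xs ++ ys)) ≡ sumℤ (map f xs) ℤ.+ sumℤ (map f ys)
  sumℤ-map-++ f []       ys = sym (ℤₚ.+-identityˡ _)
  sumℤ-map-++ f (x ∷ xs) ys = trans (cong (ℤ._+_ (f x)) (sumℤ-map-++ f xs ys)) (sym (ℤₚ.+-assoc (f x) _ _))

  sumℤ-*ˡ : ∀ c xs → sumℤ (map (ℤ._*_ c) xs) ≡ c ℤ.* sumℤ xs
  sumℤ-*ˡ c []       = sym (ℤₚ.*-zeroʳ c)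
  sumℤ-*ˡ c (x ∷ xs) = trans (cong (ℤ._+_ (c ℤ.* x)) (sumℤ-*ˡ c xs)) (sym (ℤₚ.*-distribˡ-+ c x _))

  length-tuples : ∀ m (xs : List Carrier) → length (tuples m xs) ≡ length xs ^ m
  length-tuples zero    xs = refl
  length-tuples (suc m) xs = trans (length-prefixed xs) (cong (length xs ℕ.*_) (length-tuples m xs))
    where
    ts = tuples m xs
    length-prefixed : ∀ ys → length (concatMap (λ y → map (y ∷_) ts) ys) ≡ length ys ℕ.* length ts
    length-prefixed []       = refl
    length-prefixed (y ∷ ys) =
      trans (length-++ (map (y ∷_) ts)) (cong₂ ℕ._+_ (length-map (y ∷_) ts) (length-prefixed ys))

  sumℤ-tuples : (g : Carrier → ℤ) (L : ∀ {m} → Vec Carrier m → ℤ) → L [] ≡ + 1 →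
                (∀ {m} x (αs : Vec Carrier m) → L (x ∷ αs) ≡ g x ℤ.* L αs) →
                ∀ m xs → sumℤ (map L (tuples m xs)) ≡ sumℤ (map g xs) ^ℤ m
  sumℤ-tuples g L L-[] L-∷ zero    xs = cong (ℤ._+ + 0) L-[]
  sumℤ-tuples g L L-[] L-∷ (suc m) xs =
    trans (sumℤ-prefixed xs) (cong (ℤ._*_ (sumℤ (map g xs))) (sumℤ-tuples g L L-[] L-∷ m xs))
    where
    ts = tuples m xs
    S = sumℤ (map L ts)
    sumℤ-prefix : ∀ y → sumℤ (map L (map (y ∷_) ts)) ≡ g y ℤ.* S
    sumℤ-prefix y = begin
      sumℤ (map L (map (y ∷_) ts))          ≡⟨ cong sumℤ (map-∘ ts) ⟨
      sumℤ (map (λ αs → L (y ∷ αs)) ts)     ≡⟨ cong sumℤ (map-cong (L-∷ y) ts) ⟩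
      sumℤ (map (ℤ._*_ (g y) ∘ L) ts)       ≡⟨ cong sumℤ (map-∘ ts) ⟩
      sumℤ (map (ℤ._*_ (g y)) (map L ts))   ≡⟨ sumℤ-*ˡ (g y) (map L ts) ⟩
      g y ℤ.* S                             ∎
    sumℤ-prefixed : ∀ ys → sumℤ (map L (concatMap (λ y → map (y ∷_) ts) ys)) ≡ sumℤ (map g ys) ℤ.* S
    sumℤ-prefixed []       = refl
    sumℤ-prefixed (y ∷ ys) = begin
      sumℤ (map L (map (y ∷_) ts ++ concatMap (λ y → map (y ∷_) ts) ys))
        ≡⟨ sumℤ-map-++ L (map (y ∷_) ts) _ ⟩
      sumℤ (map L (map (y ∷_) ts)) ℤ.+ sumℤ (map L (concatMap (λ y → map (y ∷_) ts) ys))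
        ≡⟨ cong₂ ℤ._+_ (sumℤ-prefix y) (sumℤ-prefixed ys) ⟩
      g y ℤ.* S ℤ.+ sumℤ (map g ys) ℤ.* S
        ≡⟨ ℤₚ.*-distribʳ-+ S (g y) (sumℤ (map g ys)) ⟨
      (g y ℤ.+ sumℤ (map g ys)) ℤ.* S     ∎

  module Trace (r : ℕ) (q≡2^[1+r] : q ≡ 2 ^ suc r) where

    open Characteristic2 (x+x≡0 {r} q≡2^[1+r])

    t : ℕ
    t = suc r

    tr-sq : ∀ x → tr t (x · x) ≡ tr t x
    tr-sq x = +-cancelʳ x _ _
      (trans (tr-sq+x≡tr+frob t x) (cong (_+_ (tr t x)) (frob-fixed {t} q≡2^[1+r] x)))

    tr-IsBit : ∀ x → IsBit (tr t x)
    tr-IsBit x = x·x≡x⇒IsBit (trans (tr²≡tr-sq t x) (tr-sq x))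

    sign-+ : ∀ {u v} → IsBit u → IsBit v → sign (u + v) ≡ sign u ℤ.* sign v
    sign-+ (inj₁ refl) (inj₁ refl) rewrite +-identityˡ 0#  | sign-0                  = refl
    sign-+ (inj₁ refl) (inj₂ refl) rewrite +-identityˡ 1#  | sign-0 | sign-≢0 1≢0   = refl
    sign-+ (inj₂ refl) (inj₁ refl) rewrite +-identityʳ 1#  | sign-0 | sign-≢0 1≢0   = refl
    sign-+ (inj₂ refl) (inj₂ refl) rewrite x+x≡0 {r} q≡2^[1+r] 1# | sign-0 | sign-≢0 1≢0   = refl

    λχ-+ : ∀ x y → λχ t (x + y) ≡ λχ t x ℤ.* λχ t y
    λχ-+ x y = begin
      λχ t (x + y)                       ≡⟨ λχ≡sign∘tr t (x + y) ⟩
      sign (tr t (x + y))                ≡⟨ cong sign (tr-+ t x y) ⟩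
      sign (tr t x + tr t y)             ≡⟨ sign-+ (tr-IsBit x) (tr-IsBit y) ⟩
      sign (tr t x) ℤ.* sign (tr t y)    ≡⟨ cong₂ ℤ._*_ (λχ≡sign∘tr t x) (λχ≡sign∘tr t y) ⟨
      λχ t x ℤ.* λχ t y                  ∎

    λχ-sq : ∀ x → λχ t (x · x) ≡ λχ t x
    λχ-sq x = trans (λχ≡sign∘tr t (x · x)) (trans (cong sign (tr-sq x)) (sym (λχ≡sign∘tr t x)))

    λχ-0 : λχ t 0# ≡ + 1
    λχ-0 = trans (λχ≡sign∘tr t 0#) (trans (cong sign (tr-0 t)) sign-0)

    √_ : Carrier → Carrier
    √ y = frob r y

    √y·√y≡y : ∀ y → √ y · √ y ≡ y
    √y·√y≡y = frob-fixed {t} q≡2^[1+r]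

    module _ {a : Carrier} (a≢0 : a ≢ 0#) where

      φ : Carrier → ℤ
      φ β = λχ t (a · (β + β ⁻¹))

      σ : Carrier → Carrier
      σ α = a ⁻¹ · (α · α)

      σ-↭-nonzero : map σ nonzero ↭ nonzero
      σ-↭-nonzero = map-↭-nonzero σ σ-injective σ-nonzero σ-surjective
        where
        a⁻¹≢0 = ⁻¹-nonzero a≢0
        σ-injective : ∀ {x y} → σ x ≡ σ y → x ≡ y
        σ-injective σx≡σy = sq-injective (·-cancelˡ a⁻¹≢0 σx≡σy)
        σ-nonzero : ∀ {x} → x ≢ 0# → σ x ≢ 0#
        σ-nonzero x≢0 = ·-nonzero a⁻¹≢0 (·-nonzero x≢0 x≢0)
        σ-surjective : ∀ {y} → y ≢ 0# → ∃ λ x → x ≢ 0# × σ x ≡ y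
        σ-surjective {y} y≢0 = √ (a · y) , √ay≢0 , σ√ay≡y
          where
          σ√ay≡y : σ (√ (a · y)) ≡ y
          σ√ay≡y = trans (cong (a ⁻¹ ·_) (√y·√y≡y (a · y))) (⁻¹·-cancelˡ y a≢0)
          √ay≢0 : √ (a · y) ≢ 0#
          √ay≢0 √ay≡0 = ·-nonzero a≢0 y≢0 (begin
            a · y              ≡⟨ √y·√y≡y (a · y) ⟨
            √ (a · y) · √ (a · y) ≡⟨ cong (λ z → z · z) √ay≡0 ⟩
            0# · 0#            ≡⟨ zeroˡ 0# ⟩
            0#                 ∎)

      σ⁻¹ : ∀ {α} → α ≢ 0# → σ α ⁻¹ ≡ a · (α ⁻¹ · α ⁻¹)
      σ⁻¹ {α} α≢0 = ⁻¹-unique (begin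
        (a ⁻¹ · (α · α)) · (a · (α ⁻¹ · α ⁻¹))
          ≡⟨ ·-interchange (a ⁻¹) (α · α) a (α ⁻¹ · α ⁻¹) ⟩
        (a ⁻¹ · a) · ((α · α) · (α ⁻¹ · α ⁻¹))
          ≡⟨ cong ((a ⁻¹ · a) ·_) (·-interchange α α (α ⁻¹) (α ⁻¹)) ⟩
        (a ⁻¹ · a) · ((α · α ⁻¹) · (α · α ⁻¹))
          ≡⟨ cong₂ _·_ (inverseˡ a a≢0) (cong (λ z → z · z) (inverseʳ α α≢0)) ⟩
        1# · (1# · 1#)
          ≡⟨ trans (*-identityˡ _) (*-identityˡ 1#) ⟩
        1# ∎)

      a[σα+σα⁻¹]≡[α+aα⁻¹]² : ∀ {α} → α ≢ 0# →
                             a · (σ α + σ α ⁻¹) ≡ (α + a · α ⁻¹) · (α + a · α ⁻¹)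
      a[σα+σα⁻¹]≡[α+aα⁻¹]² {α} α≢0 = begin
        a · (σ α + σ α ⁻¹)
          ≡⟨ cong (λ z → a · (σ α + z)) (σ⁻¹ α≢0) ⟩
        a · (a ⁻¹ · (α · α) + a · (α ⁻¹ · α ⁻¹))
          ≡⟨ distribˡ a _ _ ⟩
        a · (a ⁻¹ · (α · α)) + a · (a · (α ⁻¹ · α ⁻¹))
          ≡⟨ cong₂ _+_ (·⁻¹-cancelˡ (α · α) a≢0) (sym (*-assoc a a _)) ⟩
        α · α + (a · a) · (α ⁻¹ · α ⁻¹)
          ≡⟨ cong (_+_ (α · α)) (·-interchange a a (α ⁻¹) (α ⁻¹)) ⟩
        α · α + (a · α ⁻¹) · (a · α ⁻¹)
          ≡⟨ sq-+ α (a · α ⁻¹) ⟨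
        (α + a · α ⁻¹) · (α + a · α ⁻¹) ∎

      K≡Σφ : K t a ≡ sumℤ (map φ nonzero)
      K≡Σφ = begin
        sumℤ (map (λ α → λχ t (α + a · α ⁻¹)) nonzero)
          ≡⟨ cong sumℤ (map-cong-local (All.tabulate (λ α∈ → pointwise (∈-nonzero⁻ α∈)))) ⟩
        sumℤ (map (φ ∘ σ) nonzero)
          ≡⟨ cong sumℤ (map-∘ nonzero) ⟩
        sumℤ (map φ (map σ nonzero))
          ≡⟨ foldr-↭ ℤₚ.+-0-isCommutativeMonoid (↭-map⁺ φ σ-↭-nonzero) ⟩
        sumℤ (map φ nonzero) ∎
        where
        pointwise : ∀ {α} → α ≢ 0# → λχ t (α + a · α ⁻¹) ≡ φ (σ α)
        pointwise α≢0 = trans (sym (λχ-sq _)) (cong (λχ t) (sym (a[σα+σα⁻¹]≡[α+aα⁻¹]² α≢0)))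

      Σsign[d]≡K^m : ∀ m → sumℤ (map sign (d t m a)) ≡ K t a ^ℤ m
      Σsign[d]≡K^m m = begin
        sumℤ (map sign (map T (tuples m nonzero)))
          ≡⟨ cong sumℤ (map-∘ (tuples m nonzero)) ⟨
        sumℤ (map (sign ∘ T) (tuples m nonzero))
          ≡⟨ cong sumℤ (map-cong (λ αs → sym (λχ≡sign∘tr t (a · tupleSum αs))) (tuples m nonzero)) ⟩
        sumℤ (map L (tuples m nonzero))
          ≡⟨ sumℤ-tuples φ L L-[] L-∷ m nonzero ⟩
        sumℤ (map φ nonzero) ^ℤ m
          ≡⟨ cong (_^ℤ m) K≡Σφ ⟨
        K t a ^ℤ m ∎
        where
        T : ∀ {m} → Vec Carrier m → Carrier
        T αs = tr t (a · tupleSum αs)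
        L : ∀ {m} → Vec Carrier m → ℤ
        L αs = λχ t (a · tupleSum αs)
        L-[] : L [] ≡ + 1
        L-[] = trans (cong (λχ t) (zeroʳ a)) λχ-0
        L-∷ : ∀ {m} x (αs : Vec Carrier m) → L (x ∷ αs) ≡ φ x ℤ.* L αs
        L-∷ x αs = trans (cong (λχ t) (distribˡ a (x + x ⁻¹) (tupleSum αs))) (λχ-+ _ _)

      2*weight[d]≡N₂-K^m : ∀ m → + 2 ℤ.* + weight (d t m a) ≡ + ((q ∸ 1) ^ m) ℤ.- K t a ^ℤ m
      2*weight[d]≡N₂-K^m m = m≡n+o⇒n≡m-o (begin
        + ((q ∸ 1) ^ m)
          ≡⟨ cong (λ n → + ((n ∸ 1) ^ m)) q≡1+∣nonzero∣ ⟩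
        + (length nonzero ^ m)
          ≡⟨ cong +_ (length-tuples m nonzero) ⟨
        + length (tuples m nonzero)
          ≡⟨ cong +_ (length-map _ (tuples m nonzero)) ⟨
        + length (d t m a)
          ≡⟨ length≡2*weight+Σsign (d t m a) ⟩
        + 2 ℤ.* + weight (d t m a) ℤ.+ sumℤ (map sign (d t m a))
          ≡⟨ cong (ℤ._+_ (+ 2 ℤ.* + weight (d t m a))) (Σsign[d]≡K^m m) ⟩
        + 2 ℤ.* + weight (d t m a) ℤ.+ K t a ^ℤ m ∎)

lemma22 : (F : FiniteField) (r m : ℕ) → 0 < m →
          FF.q F ≡ 2 ^ r →
          (a : FiniteField.Carrier F) → a ≢ FiniteField.0# F →
          + 2 * + FF.weight F (FF.d F r m a)
            ≡ + ((FF.q F ∸ 1) ^ m) - (FF.K F r a) ^ℤ m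
lemma22 F zero    m _ q≡1       a a≢0 = ⊥-elim (FiniteFieldProperties.q≢1 F q≡1)
lemma22 F (suc r) m _ q≡2^[1+r] a a≢0 = FiniteFieldProperties.Trace.2*weight[d]≡N₂-K^m F r q≡2^[1+r] a≢0 m
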